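{- Let $\rho$ be a quasi-metric on a set $\Omega$, $X\subseteq\Omega$ a finite dataset, and let $W=(\Omega,X,\rho)$ be the associated quasi-metric similarity workload, whose queries are the left balls $B_\varepsilon(\omega)=\{x\in\Omega:\rho(\omega,x)<\varepsilon\}$, $\omega\in\Omega$, $\varepsilon>0$. Let $T$ be a finite rooted tree and let $B_t\subseteq\Omega$, $t\in T$, be blocks such that $X\subseteq\bigcup_{t\in L(T)}B_t\subseteq\Omega$ and, for every inner node $t$, $\bigcup_{s\in C_t}(B_s\cap X)\subseteq B_t$. Let $f_t\colon\Omega\to\mathbb R$, $t\in T$, be left 1-Lipschitz functions such that $\omega\in B_t$ implies $f_t(\omega)\le 0$. Define, for each inner node $t$, the decision function $F_t(B_\varepsilon(\omega))=\{s\in C_t: f_s(\omega)\le\varepsilon\}$. Then $(T,\{B_t\}_{t\in L(T)},\{F_t\}_{t\in I(T)})$ is a consistent indexing scheme for $W$.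
   Context: A quasi-metric on $\Omega$ is a function $\rho\colon\Omega\times\Omega\to[0,\infty)$ with $\rho(x,y)=0\iff x=y$ and satisfying the triangle inequality $\rho(x,z)\le\rho(x,y)+\rho(y,z)$, but not necessarily symmetric. A function $f\colon\Omega\to\mathbb R$ is left 1-Lipschitz if $f(x)-f(y)\le\rho(x,y)$ for all $x,y\in\Omega$. For a rooted finite tree $T$ with root $\ast$, $L(T)$ denotes the set of leaves, $I(T)$ the set of inner nodes, $C_t$ the set of children of $t$, $p(t)$ the parent of $t$. An indexing scheme on a workload $(\Omega,X,\mathcal Q)$ is a triple $(T,\{B_t\}_{t\in L(T)},\{F_t\}_{t\in I(T)})$ with $T$ a rooted finite tree, blocks $B_t\subseteq\Omega$ for leaves, and decision functions $F_t$ assigning to each query a subset of $C_t$ (here queries are given by a centre $\omega$ and radius $\varepsilon$). The search procedure on input $Q$: set $A_0=\{\ast\}$; for $i=0,1,\ldots$, for each $t\in A_i$, if $t$ is inner add all nodes of $F_t(Q)$ to $A_{i+1}$, and if $t$ is a leaf output every $x\in B_t\cap X$ with $x\in Q$; stop when $A_i=\emptyset$. The scheme is consistent if for every query $Q$ this procedure outputs exactly $Q\cap X$. -}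

module Defs where

open import Level using (Level; 0ℓ) renaming (suc to lsuc)
open import Data.List using (List; []; _∷_)
open import Data.List.Membership.Propositional using (_∈_)
open import Data.Product using (Σ; ∃; _×_; _,_)
open import Data.Sum using (_⊎_)
open import Data.Empty using (⊥)
open import Relation.Nullary using (¬_)
open import Relation.Binary.PropositionalEquality using (_≡_)

-- The real numbers, axiomatised as a complete ordered field.
-- (agda-stdlib has no reals; the theorem is quantified over every
-- model of these axioms, ℝ being one of them.)

record Reals : Set₁ where
  infixl 6 _+_ _-_
  infixl 7 _*_
  infix 4 _≤_ _<_
  field
    ℝ    : Set
    _+_  : ℝ → ℝ → ℝ
    _*_  : ℝ → ℝ → ℝ
    -_   : ℝ → ℝ
    0ℝ   : ℝ
    1ℝ   : ℝ
    _⁻¹  : (x : ℝ) → ¬ (x ≡ 0ℝ) → ℝ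
    _≤_  : ℝ → ℝ → Set
    +-assoc   : ∀ x y z → (x + y) + z ≡ x + (y + z)
    +-comm    : ∀ x y → x + y ≡ y + x
    +-identityˡ : ∀ x → 0ℝ + x ≡ x
    +-inverseˡ  : ∀ x → (- x) + x ≡ 0ℝ
    *-assoc   : ∀ x y z → (x * y) * z ≡ x * (y * z)
    *-comm    : ∀ x y → x * y ≡ y * x
    *-identityˡ : ∀ x → 1ℝ * x ≡ x
    *-inverseˡ  : ∀ x (nz : ¬ (x ≡ 0ℝ)) → (x ⁻¹) nz * x ≡ 1ℝ
    distribˡ  : ∀ x y z → x * (y + z) ≡ (x * y) + (x * z)
    0≢1       : ¬ (0ℝ ≡ 1ℝ)
    ≤-refl    : ∀ x → x ≤ x
    ≤-antisym : ∀ {x y} → x ≤ y → y ≤ x → x ≡ y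
    ≤-trans   : ∀ {x y z} → x ≤ y → y ≤ z → x ≤ z
    ≤-total   : ∀ x y → x ≤ y ⊎ y ≤ x
    +-mono-≤  : ∀ {x y} z → x ≤ y → x + z ≤ y + z
    *-nonneg  : ∀ {x y} → 0ℝ ≤ x → 0ℝ ≤ y → 0ℝ ≤ x * y
    sup : (S : ℝ → Set) → (∃ λ x → S x) → (∃ λ b → ∀ x → S x → x ≤ b) →
          ∃ λ s → (∀ x → S x → x ≤ s) × (∀ b → (∀ x → S x → x ≤ b) → s ≤ b)

  _-_ : ℝ → ℝ → ℝ
  x - y = x + (- y)

  _<_ : ℝ → ℝ → Set
  x < y = x ≤ y × ¬ (x ≡ y)

module _ (R : Reals) where
  open Reals R

  record IsQuasiMetric {Ω : Set} (ρ : Ω → Ω → ℝ) : Set where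
    field
      nonneg   : ∀ x y → 0ℝ ≤ ρ x y
      zero⇒eq  : ∀ x y → ρ x y ≡ 0ℝ → x ≡ y
      eq⇒zero  : ∀ x → ρ x x ≡ 0ℝ
      triangle : ∀ x y z → ρ x z ≤ ρ x y + ρ y z

  LeftLipschitz : {Ω : Set} (ρ : Ω → Ω → ℝ) → (Ω → ℝ) → Set
  LeftLipschitz ρ f = ∀ x y → f x - f y ≤ ρ x y

-- Nodes are referred to through their labels (blocks and functions
-- are assigned to labels); quantifying over all N and T covers trees
-- with pairwise distinct labels, i.e. arbitrary assignments.

data Tree (N : Set) : Set where
  node : N → List (Tree N) → Tree N

label : ∀ {N} → Tree N → N
label (node n _) = n

children : ∀ {N} → Tree N → List (Tree N)
children (node _ cs) = cs

IsLeaf : ∀ {N} → Tree N → Set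
IsLeaf t = children t ≡ []

data _⊑_ {N : Set} : Tree N → Tree N → Set where
  root  : ∀ {t} → t ⊑ t
  below : ∀ {t s u} → t ⊑ u → s ∈ children t → s ⊑ u

-- Queries are subsets of Ω given by a query type Qry and an
-- interpretation ⟦_⟧.  Decision function at an inner node t:
-- F t q s  means child s ∈ C_t is selected, i.e. s ∈ F_t(q).

module Search {Ω N Qry : Set} (⟦_⟧ : Qry → Ω → Set)
              (X : List Ω) (T : Tree N)
              (B : N → Ω → Set)
              (F : Tree N → Qry → Tree N → Set) where

  -- nodes put into some A_i by the search procedure on input q
  data Visited (q : Qry) : Tree N → Set where
    start : Visited q T
    step  : ∀ {t s} → Visited q t → s ∈ children t → F t q s → Visited q s

  Output : Qry → Ω → Set
  Output q x = ∃ λ t → Visited q t × IsLeaf t × B (label t) x × x ∈ X × ⟦ q ⟧ x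

  Consistent : Set
  Consistent = ∀ q x → (Output q x → x ∈ X × ⟦ q ⟧ x) × (x ∈ X × ⟦ q ⟧ x → Output q x)

module _ (R : Reals) where
  open Reals R

  BallQuery : Set → Set
  BallQuery Ω = Σ Ω λ ω → Σ ℝ λ ε → 0ℝ < ε

  leftBall : {Ω : Set} → (Ω → Ω → ℝ) → BallQuery Ω → Ω → Set
  leftBall ρ (ω , ε , _) x = ρ ω x < ε

  lipDecision : {Ω N : Set} → (N → Ω → ℝ) → Tree N → BallQuery Ω → Tree N → Set
  lipDecision f t (ω , ε , _) s = f (label s) ω ≤ ε

{-# OPTIONS --safe #-}
module Submission where

-- A child s of a visited node is pruned only if f_s(ω) > ε.  If x ∈ X lies in
-- the query ball and in B_s, then f_s(x) ≤ 0 and the Lipschitz condition give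
-- f_s(ω) ≤ f_s(x) + ρ(ω,x) ≤ ρ(ω,x) < ε, so s is selected.  The blocks on the
-- path from the root to a leaf whose block contains x all contain x, so that
-- whole path is visited and x is output.

open import Defs
open import Data.List using (List)
open import Data.List.Membership.Propositional using (_∈_)
open import Data.Product using (∃; _×_; _,_)
open import Relation.Binary.PropositionalEquality using (_≡_; trans; cong; subst)

module OrderedFieldProperties (R : Reals) where
  open Reals R

  x-y+y≡x : ∀ x y → (x - y) + y ≡ x
  x-y+y≡x x y = trans (+-assoc x (- y) y)
    (trans (cong (x +_) (+-inverseˡ y)) (trans (+-comm x 0ℝ) (+-identityˡ x)))

  y≤0⇒x+y≤x : ∀ {x y} → y ≤ 0ℝ → x + y ≤ x
  y≤0⇒x+y≤x {x} {y} y≤0 =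
    subst (_≤ x) (+-comm y x) (subst (y + x ≤_) (+-identityˡ x) (+-mono-≤ x y≤0))

  x-y≤z∧y≤0⇒x≤z : ∀ {x y z} → x - y ≤ z → y ≤ 0ℝ → x ≤ z
  x-y≤z∧y≤0⇒x≤z {x} {y} {z} x-y≤z y≤0 =
    subst (_≤ z) (x-y+y≡x x y) (≤-trans (+-mono-≤ y x-y≤z) (y≤0⇒x+y≤x y≤0))

  leftLipschitz∧nonpos⇒≤ρ : ∀ {Ω} {ρ : Ω → Ω → ℝ} {f : Ω → ℝ} {ω x} →
    LeftLipschitz R ρ f → f x ≤ 0ℝ → f ω ≤ ρ ω x
  leftLipschitz∧nonpos⇒≤ρ {ω = ω} {x} lip fx≤0 = x-y≤z∧y≤0⇒x≤z (lip ω x) fx≤0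

module SearchProperties {Ω N Qry : Set} (⟦_⟧ : Qry → Ω → Set)
                        (X : List Ω) (T : Tree N) (B : N → Ω → Set)
                        (F : Tree N → Qry → Tree N → Set) where
  open Search ⟦_⟧ X T B F

  output-sound : ∀ {q x} → Output q x → x ∈ X × ⟦ q ⟧ x
  output-sound (_ , _ , _ , _ , x∈X , x∈q) = x∈X , x∈q

  visited-upward-closed : (q : Qry) (P : Tree N → Set) →
    (∀ t → t ⊑ T → ∀ s → s ∈ children t → P s → P t) →
    (∀ t → t ⊑ T → ∀ s → s ∈ children t → P s → F t q s) →
    ∀ s → s ⊑ T → P s → Visited q s
  visited-upward-closed q P closed selected s root _ = start
  visited-upward-closed q P closed selected s (below {t} t⊑T s∈t) Ps =
    step (visited-upward-closed q P closed selected t t⊑T (closed t t⊑T s s∈t Ps))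
         s∈t (selected t t⊑T s s∈t Ps)

  consistent-if-answers-never-pruned :
    (∀ x → x ∈ X → ∃ λ t → t ⊑ T × IsLeaf t × B (label t) x) →
    (∀ t → t ⊑ T → ∀ s → s ∈ children t → ∀ x → B (label s) x → x ∈ X → B (label t) x) →
    (∀ q x → x ∈ X → ⟦ q ⟧ x → ∀ t → t ⊑ T → ∀ s → s ∈ children t → B (label s) x → F t q s) →
    Consistent
  consistent-if-answers-never-pruned cover up never-pruned q x =
    output-sound , complete
    where
    complete : x ∈ X × ⟦ q ⟧ x → Output q x
    complete (x∈X , x∈q) =
      let t , t⊑T , leaf , x∈Bt = cover x x∈X
          visited = visited-upward-closed q (λ s → B (label s) x)
                      (λ t t⊑T s s∈t x∈Bs → up t t⊑T s s∈t x x∈Bs x∈X)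
                      (never-pruned q x x∈X x∈q) t t⊑T x∈Bt
      in t , visited , leaf , x∈Bt , x∈X , x∈q

theorem3p16 : (R : Reals) → let open Reals R in
    {Ω N : Set} (ρ : Ω → Ω → ℝ) → IsQuasiMetric R ρ →
    (X : List Ω) (T : Tree N) (B : N → Ω → Set) (f : N → Ω → ℝ) →
    (∀ x → x ∈ X → ∃ λ t → t ⊑ T × IsLeaf t × B (label t) x) →
    (∀ t → t ⊑ T → ∀ s → s ∈ children t → ∀ x → B (label s) x → x ∈ X → B (label t) x) →
    (∀ t → t ⊑ T → LeftLipschitz R ρ (f (label t))) →
    (∀ t → t ⊑ T → ∀ ω → B (label t) ω → f (label t) ω ≤ 0ℝ) →
    Search.Consistent (leftBall R ρ) X T B (lipDecision R f)
theorem3p16 R ρ _ X T B f cover up lip nonpos =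
  consistent-if-answers-never-pruned cover up never-pruned
  where
  open Reals R
  open OrderedFieldProperties R
  open SearchProperties (leftBall R ρ) X T B (lipDecision R f)

  never-pruned : ∀ q x → x ∈ X → leftBall R ρ q x →
    ∀ t → t ⊑ T → ∀ s → s ∈ children t → B (label s) x → lipDecision R f t q s
  never-pruned (ω , ε , _) x _ (ρωx≤ε , _) t t⊑T s s∈t x∈Bs =
    let s⊑T = below t⊑T s∈t
    in ≤-trans (leftLipschitz∧nonpos⇒≤ρ (lip s s⊑T) (nonpos s s⊑T x x∈Bs)) ρωx≤ε
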